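{- Let $n$ be a positive integer and $r$ an integer with $r\geq\lceil n/\sqrt{3}\rceil+1$. Then the pulse $K(n,r)$ cannot terminate in the Aztec diamond $\mathrm{Az}(n)$, i.e., no finite sequence of firing moves from $K(n,r)$ reaches $\mathrm{Az}(n)$.
   Context: The grid complex is the tiling of the plane by unit squares ("faces"); two faces are adjacent if they share an edge, and $\mathrm{dist}(f,g)$ is the Manhattan distance between faces. A configuration $K$ assigns an integer weight $K_f$ to each face $f$, with finitely many nonzero weights; there is a marked face $f_0$ with $K_{f_0}=n$. Firing moves: (i) if $f,g$ are adjacent faces, both different from $f_0$, with $K_f\geq K_g+2$, one may fire $f$ towards $g$, decreasing $K_f$ by $1$ and increasing $K_g$ by $1$; (ii) if $g$ is adjacent to $f_0$ and $K_g<n$, one may fire from $f_0$ to $g$, increasing $K_g$ by $1$; (iii) if $g$ is adjacent to $f_0$ and $K_g>n$, one may fire from $g$ to $f_0$, decreasing $K_g$ by $1$; the weight of $f_0$ never changes. The pulse $K(n,r)$ has $K(n,r)_f=n$ if $\mathrm{dist}(f_0,f)\leq r$ and $0$ otherwise. The Aztec diamond $\mathrm{Az}(n)$ has $\mathrm{Az}(n)_{f_0}=n$ and $\mathrm{Az}(n)_f=\max\{n-\mathrm{dist}(f_0,f)+1,0\}$ for $f\neq f_0$. -}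

module Defs where

open import Data.Nat as ℕ using (ℕ; suc)
open import Data.Integer using (ℤ; +_; _+_; _-_; _*_; _≤_; _<_; ∣_∣; _⊔_)
open import Data.Integer.Base using (-_)
open import Data.Product using (_×_; _,_; Σ; ∃)
open import Data.Sum using (_⊎_)
open import Relation.Binary.PropositionalEquality using (_≡_; _≢_)
open import Relation.Binary.Construct.Closure.ReflexiveTransitive using (Star)
open import Relation.Nullary using (Dec)

-- Faces of the grid complex are indexed by their (integer) coordinates.
Face : Set
Face = ℤ × ℤ

f₀ : Face
f₀ = (+ 0 , + 0)

dist : Face → Face → ℕ
dist (a , b) (c , d) = ∣ a - c ∣ ℕ.+ ∣ b - d ∣

-- Two faces are adjacent iff they share an edge, i.e. Manhattan distance 1.
Adjacent : Face → Face → Set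
Adjacent f g = dist f g ≡ 1

Config : Set
Config = Face → ℤ

data Fire (n : ℕ) (K K' : Config) : Set where
  fire-adj : (f g : Face) → Adjacent f g → f ≢ f₀ → g ≢ f₀ →
            K g + + 2 ≤ K f →
            K' f ≡ K f - + 1 → K' g ≡ K g + + 1 →
            (∀ h → h ≢ f → h ≢ g → K' h ≡ K h) → Fire n K K'
  fire-from-f₀ : (g : Face) → Adjacent f₀ g → K g < + n →
            K' g ≡ K g + + 1 →
            (∀ h → h ≢ g → K' h ≡ K h) → Fire n K K'
  fire-to-f₀ : (g : Face) → Adjacent f₀ g → + n < K g →
            K' g ≡ K g - + 1 →
            (∀ h → h ≢ g → K' h ≡ K h) → Fire n K K'

Reaches : ℕ → Config → Config → Set
Reaches n = Star (Fire n)

_≗c_ : Config → Config → Set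
K ≗c L = ∀ f → K f ≡ L f

import Data.Integer.Properties as ℤP
open import Relation.Nullary using (yes; no)

pulse : ℕ → ℤ → Config
pulse n r f with (+ dist f₀ f) ℤP.≤? r
... | yes _ = + n
... | no _ = + 0

open import Data.Product.Properties using (≡-dec)
_≟F_ : (f g : Face) → Dec (f ≡ g)
_≟F_ = ≡-dec ℤP._≟_ ℤP._≟_

aztec : ℕ → Config
aztec n f with f ≟F f₀
... | yes _ = + n
... | no _ = (+ n - + dist f₀ f + + 1) ⊔ + 0

-- c = ⌈ n / √3 ⌉ for a natural number n: c is the least natural number
-- with c ≥ n/√3, i.e. with 3c² ≥ n² (both sides nonnegative).
IsCeilDivSqrt3 : ℕ → ℕ → Set
IsCeilDivSqrt3 n c =
  (n ℕ.* n ℕ.≤ 3 ℕ.* (c ℕ.* c)) × (∀ m → n ℕ.* n ℕ.≤ 3 ℕ.* (m ℕ.* m) → c ℕ.≤ m)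

-- Along a firing sequence from the pulse no weight ever exceeds n, so move (iii) never applies:
-- moves (i) preserve the total weight and moves (ii) increase it. Supports stay finite, so the
-- total weight can be read off on a large enough square, where it is at least n(2r² + 2r + 1),
-- the weight of the pulse. Summing over the faces at each distance from f₀ (triangular and
-- tetrahedral numbers), Az(n) weighs at most 1 + n + 2n(n+1)(n+2)/3, and 3(r − 1)² ≥ n² makes
-- this strictly smaller.
module Submission where

open import Defs
open import Data.Nat using (ℕ; suc; _≤_)
open import Data.Integer using (ℤ; +_) renaming (_≤_ to _≤ℤ_)
open import Data.Product using (∃; _×_)
open import Relation.Nullary using (¬_)

open import Data.Nat as ℕ using (zero; _<_; z≤n; s≤s)
import Data.Nat.Properties as ℕ
open import Data.Product using (_,_; proj₁; proj₂)
open import Data.Empty using (⊥-elim)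
open import Function using (_∘_)
open import Relation.Binary.PropositionalEquality
open import Relation.Binary.Construct.Closure.ReflexiveTransitive using (ε; _◅_)
open import Relation.Nullary using (Dec; yes; no)
import Algebra.Properties.CommutativeSemigroup ℕ.+-commutativeSemigroup as ℕ+

module Arithmetic where

  open import Data.Nat using (_+_; _*_; _∸_)
  open import Data.Nat.Properties
  open import Data.Nat.Tactic.RingSolver using (solve-∀; solve)
  open import Data.List using (_∷_; [])

  tri : ℕ → ℕ
  tri zero    = 0
  tri (suc x) = suc x + tri x

  tet : ℕ → ℕ
  tet zero    = 0
  tet (suc x) = tri (suc x) + tet x

  record IsRunningSum (g G : ℕ → ℕ) : Set where
    field
      g-zero : g 0 ≡ 0
      G-zero : G 0 ≡ 0
      G-suc  : ∀ x → G (suc x) ≡ g (suc x) + G x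

  tri-runningSum : IsRunningSum (λ x → x) tri
  tri-runningSum = record { g-zero = refl ; G-zero = refl ; G-suc = λ _ → refl }

  tet-runningSum : IsRunningSum tri tet
  tet-runningSum = record { g-zero = refl ; G-zero = refl ; G-suc = λ _ → refl }

  *-runningSum : ∀ k {g G} → IsRunningSum g G → IsRunningSum (λ x → k * g x) (λ x → k * G x)
  *-runningSum k run = record
    { g-zero = trans (cong (k *_) g-zero) (*-zeroʳ k)
    ; G-zero = trans (cong (k *_) G-zero) (*-zeroʳ k)
    ; G-suc  = λ x → trans (cong (k *_) (G-suc x)) (*-distribˡ-+ k _ _)
    }
    where open IsRunningSum run

  twoSided : (ℕ → ℕ) → ℕ → ℕ
  twoSided G m = G m + G (m ∸ 1)

  twoSided-runningSum : ∀ {g G} → IsRunningSum g G → IsRunningSum (twoSided g) (twoSided G)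
  twoSided-runningSum {g} {G} run = record
    { g-zero = cong₂ _+_ g-zero g-zero
    ; G-zero = cong₂ _+_ G-zero G-zero
    ; G-suc  = λ x → trans (cong₂ _+_ (G-suc x) (G-pred x))
                           (ℕ+.interchange (g (suc x)) (G x) (g x) (G (x ∸ 1)))
    }
    where
    open IsRunningSum run
    G-pred : ∀ x → G x ≡ g x + G (x ∸ 1)
    G-pred zero    = trans G-zero (sym (cong₂ _+_ g-zero G-zero))
    G-pred (suc x) = G-suc x

  twoSided-cong : ∀ {G H} → (∀ x → G x ≡ H x) → ∀ m → twoSided G m ≡ twoSided H m
  twoSided-cong G≗H m = cong₂ _+_ (G≗H m) (G≗H (m ∸ 1))

  *-distribˡ-twoSided² : ∀ k H m →
                         k * twoSided (twoSided H) m ≡ twoSided (twoSided (λ x → k * H x)) m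
  *-distribˡ-twoSided² k H m =
    trans (distrib (twoSided H) m) (twoSided-cong (distrib H) m)
    where
    distrib : ∀ G m → k * twoSided G m ≡ twoSided (λ x → k * G x) m
    distrib G m = *-distribˡ-+ k (G m) (G (m ∸ 1))

  2*tri : ∀ x → 2 * tri x ≡ x * suc x
  2*tri zero    = refl
  2*tri (suc x) = begin
    2 * (suc x + tri x)     ≡⟨ *-distribˡ-+ 2 (suc x) (tri x) ⟩
    2 * suc x + 2 * tri x   ≡⟨ cong (λ t → 2 * suc x + t) (2*tri x) ⟩
    2 * suc x + x * suc x   ≡⟨ solve (x ∷ []) ⟩
    suc x * suc (suc x)     ∎
    where open ≡-Reasoning

  6*tet : ∀ x → 6 * tet x ≡ x * suc x * suc (suc x)
  6*tet zero    = refl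
  6*tet (suc x) = begin
    6 * (tri (suc x) + tet x)
      ≡⟨ *-distribˡ-+ 6 (tri (suc x)) (tet x) ⟩
    6 * tri (suc x) + 6 * tet x
      ≡⟨ cong₂ _+_ (*-assoc 3 2 (tri (suc x))) (6*tet x) ⟩
    3 * (2 * tri (suc x)) + x * suc x * suc (suc x)
      ≡⟨ cong (λ t → 3 * t + x * suc x * suc (suc x)) (2*tri (suc x)) ⟩
    3 * (suc x * suc (suc x)) + x * suc x * suc (suc x)
      ≡⟨ solve (x ∷ []) ⟩
    suc x * suc (suc x) * suc (suc (suc x)) ∎
    where open ≡-Reasoning

  2*twoSided²-tri : ∀ q → 2 * twoSided (twoSided tri) (suc (suc q)) ≡ 4 * (q * q) + 12 * q + 10
  2*twoSided²-tri q = begin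
    2 * twoSided (twoSided tri) (suc (suc q))
      ≡⟨ *-distribˡ-twoSided² 2 tri (suc (suc q)) ⟩
    twoSided (twoSided (λ x → 2 * tri x)) (suc (suc q))
      ≡⟨ twoSided-cong (twoSided-cong 2*tri) (suc (suc q)) ⟩
    (suc (suc q) * suc (suc (suc q)) + suc q * suc (suc q)) + (suc q * suc (suc q) + q * suc q)
      ≡⟨ solve (q ∷ []) ⟩
    4 * (q * q) + 12 * q + 10 ∎
    where open ≡-Reasoning

  6*twoSided²-tet : ∀ m → 6 * twoSided (twoSided tet) (suc (suc m)) ≡
                          4 * (suc m * suc m * suc m) + 12 * (suc m * suc m) + 14 * suc m + 6
  6*twoSided²-tet m = begin
    6 * twoSided (twoSided tet) (suc (suc m))
      ≡⟨ *-distribˡ-twoSided² 6 tet (suc (suc m)) ⟩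
    twoSided (twoSided (λ x → 6 * tet x)) (suc (suc m))
      ≡⟨ twoSided-cong (twoSided-cong 6*tet) (suc (suc m)) ⟩
    (suc (suc m) * suc (suc (suc m)) * suc (suc (suc (suc m)))
       + suc m * suc (suc m) * suc (suc (suc m)))
      + (suc m * suc (suc m) * suc (suc (suc m)) + m * suc m * suc (suc m))
      ≡⟨ solve (m ∷ []) ⟩
    4 * (suc m * suc m * suc m) + 12 * (suc m * suc m) + 14 * suc m + 6 ∎
    where open ≡-Reasoning

  square-≤⇒≤ : ∀ {m n} → m * m ≤ n * n → m ≤ n
  square-≤⇒≤ m²≤n² = ≮⇒≥ (λ n<m → <⇒≱ (*-mono-< n<m n<m) m²≤n²)

  twoSided²-tet<twoSided²-tri : ∀ m q → suc m * suc m ≤ 3 * (q * q) →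
    twoSided (twoSided tet) (suc (suc m)) < suc m * twoSided (twoSided tri) (suc (suc q))
  twoSided²-tet<twoSided²-tri m q n²≤3q² = *-cancelˡ-< 6 _ _ (begin-strict
    6 * twoSided (twoSided tet) (suc (suc m))
      ≡⟨ 6*twoSided²-tet m ⟩
    4 * (suc m * suc m * suc m) + 12 * (suc m * suc m) + 14 * suc m + 6
      <⟨ m<m+n _ (s≤s z≤n) ⟩
    4 * (suc m * suc m * suc m) + 12 * (suc m * suc m) + 14 * suc m + 6 + (10 + 16 * m)
      ≡⟨ solve (m ∷ []) ⟩
    suc m * (4 * (suc m * suc m) + 12 * suc m + 30)
      ≤⟨ *-monoʳ-≤ (suc m) (+-monoˡ-≤ 30 (+-mono-≤ (*-monoʳ-≤ 4 n²≤3q²)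
                                                    (*-monoʳ-≤ 12 n≤3q))) ⟩
    suc m * (4 * (3 * (q * q)) + 12 * (3 * q) + 30)
      ≡⟨ solve (m ∷ q ∷ []) ⟩
    3 * (suc m * (4 * (q * q) + 12 * q + 10))
      ≡⟨ cong (λ t → 3 * (suc m * t)) (2*twoSided²-tri q) ⟨
    3 * (suc m * (2 * twoSided (twoSided tri) (suc (suc q))))
      ≡⟨ regroup (suc m) (twoSided (twoSided tri) (suc (suc q))) ⟩
    6 * (suc m * twoSided (twoSided tri) (suc (suc q))) ∎)
    where
    open ≤-Reasoning
    n≤3q : suc m ≤ 3 * q
    n≤3q = square-≤⇒≤ (begin
      suc m * suc m    ≤⟨ n²≤3q² ⟩
      3 * (q * q)      ≤⟨ *-monoˡ-≤ (q * q) {3} {9} (s≤s (s≤s (s≤s z≤n))) ⟩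
      9 * (q * q)      ≡⟨ solve (q ∷ []) ⟩
      3 * q * (3 * q)  ∎)
    regroup : ∀ a b → 3 * (a * (2 * b)) ≡ 6 * (a * b)
    regroup = solve-∀

open Arithmetic

open import Data.Integer as ℤ using (-[1+_]; +≤+; ∣_∣; _+_; _-_) renaming (_<_ to _<ℤ_)
import Data.Integer.Properties as ℤ
open import Data.Integer.Tactic.RingSolver using (solve-∀)
open import Algebra.Properties.CommutativeSemigroup ℤ.+-commutativeSemigroup using (interchange)
open import Algebra.Properties.AbelianGroup ℤ.+-0-abelianGroup
  using () renaming (∙-cancelʳ to +-cancelʳ)

∑ : ℕ → (ℕ → ℤ) → ℤ
∑ zero    f = + 0
∑ (suc R) f = f 0 + ∑ R (λ i → f (suc i))

infix 5 ∑
syntax ∑ R (λ i → e) = ∑[ i < R ] e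

∑-cong : ∀ R {f g : ℕ → ℤ} → (∀ i → f i ≡ g i) → ∑ R f ≡ ∑ R g
∑-cong zero    f≗g = refl
∑-cong (suc R) f≗g = cong₂ _+_ (f≗g 0) (∑-cong R (λ i → f≗g (suc i)))

∑-mono-≤ : ∀ R {f g : ℕ → ℤ} → (∀ i → f i ≤ℤ g i) → ∑ R f ≤ℤ ∑ R g
∑-mono-≤ zero    f≤g = ℤ.≤-refl
∑-mono-≤ (suc R) f≤g = ℤ.+-mono-≤ (f≤g 0) (∑-mono-≤ R (λ i → f≤g (suc i)))

∑-distrib-+ : ∀ R (f g : ℕ → ℤ) → ∑[ i < R ] (f i + g i) ≡ ∑ R f + ∑ R g
∑-distrib-+ zero    f g = refl
∑-distrib-+ (suc R) f g =
  trans (cong (λ s → f 0 + g 0 + s) (∑-distrib-+ R (λ i → f (suc i)) (λ i → g (suc i))))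
        (interchange (f 0) (g 0) _ _)

∑-zero : ∀ R {f : ℕ → ℤ} → (∀ i → f i ≡ + 0) → ∑ R f ≡ + 0
∑-zero zero    f≗0 = refl
∑-zero (suc R) f≗0 = cong₂ _+_ (f≗0 0) (∑-zero R (λ i → f≗0 (suc i)))

∑-single : ∀ R {k} {f : ℕ → ℤ} → k < R → (∀ i → i ≢ k → f i ≡ + 0) → ∑ R f ≡ f k
∑-single (suc R) {zero} {f} _ f≗0 =
  trans (cong (λ s → f 0 + s) (∑-zero R (λ i → f≗0 (suc i) λ ()))) (ℤ.+-identityʳ (f 0))
∑-single (suc R) {suc k} {f} (s≤s k<R) f≗0 =
  trans (cong (_+ ∑ R (λ i → f (suc i))) (f≗0 0 λ ()))
        (trans (ℤ.+-identityˡ _)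
               (∑-single R {f = λ i → f (suc i)} k<R
                         (λ i i≢k → f≗0 (suc i) (i≢k ∘ ℕ.suc-injective))))

∑-runningSum : ∀ {g G} → IsRunningSum g G → ∀ {m} R → m ≤ R →
               ∑[ i < R ] + g (m ℕ.∸ i) ≡ + G m
∑-runningSum {g} run {zero} R _ =
  trans (∑-zero R (λ i → cong +_ (trans (cong g (ℕ.0∸n≡0 i)) g-zero))) (cong +_ (sym G-zero))
  where open IsRunningSum run
∑-runningSum run {suc m} (suc R) (s≤s m≤R) =
  trans (cong (λ s → + _ + s) (∑-runningSum run R m≤R)) (cong +_ (sym (G-suc m)))
  where open IsRunningSum run

-- The sum of h over the integers in [-R, R).
∑± : ℕ → (ℤ → ℤ) → ℤ
∑± R h = ∑[ i < R ] (h (+ i) + h -[1+ i ])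

∑±-cong : ∀ R {h k : ℤ → ℤ} → (∀ x → h x ≡ k x) → ∑± R h ≡ ∑± R k
∑±-cong R h≗k = ∑-cong R (λ i → cong₂ _+_ (h≗k _) (h≗k _))

∑±-mono-≤ : ∀ R {h k : ℤ → ℤ} → (∀ x → h x ≤ℤ k x) → ∑± R h ≤ℤ ∑± R k
∑±-mono-≤ R h≤k = ∑-mono-≤ R (λ i → ℤ.+-mono-≤ (h≤k _) (h≤k _))

∑±-distrib-+ : ∀ R (h k : ℤ → ℤ) → ∑± R (λ x → h x + k x) ≡ ∑± R h + ∑± R k
∑±-distrib-+ R h k =
  trans (∑-cong R (λ i → interchange (h (+ i)) (k (+ i)) (h -[1+ i ]) (k -[1+ i ])))
        (∑-distrib-+ R _ _)

index : ℤ → ℕ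
index (+ i)    = i
index -[1+ i ] = i

∑±-single : ∀ R {a} {h : ℤ → ℤ} → ∣ a ∣ < R → (∀ x → x ≢ a → h x ≡ + 0) → ∑± R h ≡ h a
∑±-single R {a} {h} ∣a∣<R h≗0 =
  trans (∑-single R (index<R a ∣a∣<R)
                    (λ i i≢ → cong₂ _+_ (h≗0 _ (i≢ ∘ cong index)) (h≗0 _ (i≢ ∘ cong index))))
        (pair-at a h≗0)
  where
  index<R : ∀ a → ∣ a ∣ < R → index a < R
  index<R (+ i)    i<R = i<R
  index<R -[1+ i ] i<R = ℕ.<-trans (ℕ.n<1+n i) i<R
  pair-at : ∀ a → (∀ x → x ≢ a → h x ≡ + 0) → h (+ index a) + h -[1+ index a ] ≡ h a
  pair-at (+ i)    h≗0 = trans (cong (λ s → h (+ i) + s) (h≗0 _ λ ())) (ℤ.+-identityʳ _)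
  pair-at -[1+ i ] h≗0 = trans (cong (_+ h -[1+ i ]) (h≗0 _ λ ())) (ℤ.+-identityˡ _)

‖_‖ : Face → ℕ
‖ f ‖ = dist f₀ f

‖a,b‖≡∣a∣+∣b∣ : ∀ a b → ‖ (a , b) ‖ ≡ ∣ a ∣ ℕ.+ ∣ b ∣
‖a,b‖≡∣a∣+∣b∣ a b = cong₂ ℕ._+_ (∣0-i∣ a) (∣0-i∣ b)
  where
  ∣0-i∣ : ∀ i → ∣ + 0 - i ∣ ≡ ∣ i ∣
  ∣0-i∣ i = trans (cong ∣_∣ (ℤ.+-identityˡ (ℤ.- i))) (ℤ.∣-i∣≡∣i∣ i)

mass : ℕ → Config → ℤ
mass R K = ∑± R λ x → ∑± R λ y → K (x , y)

mass-cong : ∀ R {K L : Config} → (∀ f → K f ≡ L f) → mass R K ≡ mass R L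
mass-cong R K≗L = ∑±-cong R (λ x → ∑±-cong R (λ y → K≗L (x , y)))

mass-mono-≤ : ∀ R {K L : Config} → (∀ f → K f ≤ℤ L f) → mass R K ≤ℤ mass R L
mass-mono-≤ R K≤L = ∑±-mono-≤ R (λ x → ∑±-mono-≤ R (λ y → K≤L (x , y)))

mass-distrib-+ : ∀ R (K L : Config) → mass R (λ f → K f + L f) ≡ mass R K + mass R L
mass-distrib-+ R K L =
  trans (∑±-cong R (λ x → ∑±-distrib-+ R (λ y → K (x , y)) (λ y → L (x , y))))
        (∑±-distrib-+ R (λ x → ∑± R (λ y → K (x , y))) (λ x → ∑± R (λ y → L (x , y))))

δ : Face → Config
δ p h with h ≟F p
... | yes _ = + 1
... | no  _ = + 0

δ-same : ∀ p → δ p p ≡ + 1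
δ-same p with p ≟F p
... | yes _   = refl
... | no p≢p = ⊥-elim (p≢p refl)

δ-other : ∀ {p h} → h ≢ p → δ p h ≡ + 0
δ-other {p} {h} h≢p with h ≟F p
... | yes h≡p = ⊥-elim (h≢p h≡p)
... | no  _   = refl

mass-δ : ∀ R p → ‖ p ‖ < R → mass R (δ p) ≡ + 1
mass-δ R (a , b) ‖p‖<R = begin
  mass R (δ (a , b))
    ≡⟨ ∑±-cong R (λ x → ∑±-single R {h = λ y → δ (a , b) (x , y)} ∣b∣<R
                                   (λ y y≢b → δ-other (y≢b ∘ cong proj₂))) ⟩
  ∑± R (λ x → δ (a , b) (x , b))
    ≡⟨ ∑±-single R {h = λ x → δ (a , b) (x , b)} ∣a∣<R
                   (λ x x≢a → δ-other (x≢a ∘ cong proj₁)) ⟩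
  δ (a , b) (a , b)
    ≡⟨ δ-same (a , b) ⟩
  + 1 ∎
  where
  open ≡-Reasoning
  ∣a∣+∣b∣<R : ∣ a ∣ ℕ.+ ∣ b ∣ < R
  ∣a∣+∣b∣<R = subst (_< R) (‖a,b‖≡∣a∣+∣b∣ a b) ‖p‖<R
  ∣a∣<R = ℕ.≤-<-trans (ℕ.m≤m+n ∣ a ∣ ∣ b ∣) ∣a∣+∣b∣<R
  ∣b∣<R = ℕ.≤-<-trans (ℕ.m≤n+m ∣ b ∣ ∣ a ∣) ∣a∣+∣b∣<R

∑±-radial : ∀ {g G} → IsRunningSum g G → ∀ {m} R → m ≤ R →
            ∑± R (λ y → + g (m ℕ.∸ ∣ y ∣)) ≡ + twoSided G m
∑±-radial {g} {G} run {m} R m≤R = begin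
  ∑± R (λ y → + g (m ℕ.∸ ∣ y ∣))
    ≡⟨ ∑-distrib-+ R (λ i → + g (m ℕ.∸ i)) (λ i → + g (m ℕ.∸ suc i)) ⟩
  (∑[ i < R ] + g (m ℕ.∸ i)) + (∑[ i < R ] + g (m ℕ.∸ suc i))
    ≡⟨ cong₂ _+_ (∑-runningSum run R m≤R)
                 (trans (∑-cong R (λ i → cong (+_ ∘ g) (sym (ℕ.∸-+-assoc m 1 i))))
                        (∑-runningSum run R (ℕ.≤-trans (ℕ.m∸n≤m m 1) m≤R))) ⟩
  + twoSided G m ∎
  where open ≡-Reasoning

mass-radial : ∀ {g G H} → IsRunningSum g G → IsRunningSum G H → ∀ {m} R → m ≤ R →
              mass R (λ f → + g (m ℕ.∸ ‖ f ‖)) ≡ + twoSided (twoSided H) m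
mass-radial {g} {G} {H} run₁ run₂ {m} R m≤R = begin
  mass R (λ f → + g (m ℕ.∸ ‖ f ‖))
    ≡⟨ mass-cong R (λ (x , y) → cong (+_ ∘ g) (trans (cong (m ℕ.∸_) (‖a,b‖≡∣a∣+∣b∣ x y))
                                                      (sym (ℕ.∸-+-assoc m ∣ x ∣ ∣ y ∣)))) ⟩
  ∑± R (λ x → ∑± R (λ y → + g (m ℕ.∸ ∣ x ∣ ℕ.∸ ∣ y ∣)))
    ≡⟨ ∑±-cong R (λ x → ∑±-radial run₁ R (ℕ.≤-trans (ℕ.m∸n≤m m ∣ x ∣) m≤R)) ⟩
  ∑± R (λ x → + twoSided G (m ℕ.∸ ∣ x ∣))
    ≡⟨ ∑±-radial (twoSided-runningSum run₂) R m≤R ⟩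
  + twoSided (twoSided H) m ∎
  where open ≡-Reasoning

plateau : ℕ → ℕ → ℕ
plateau n zero    = 0
plateau n (suc _) = n

pulse-radial : ∀ n r f → pulse n (+ r) f ≡ + plateau n (suc r ℕ.∸ ‖ f ‖)
pulse-radial n r f with + ‖ f ‖ ℤ.≤? + r
... | yes ‖f‖≤r = sym (cong (+_ ∘ plateau n) (ℕ.+-∸-assoc 1 (ℤ.drop‿+≤+ ‖f‖≤r)))
... | no  ‖f‖≰r = sym (cong (+_ ∘ plateau n) (ℕ.m≤n⇒m∸n≡0 (ℕ.≰⇒> (‖f‖≰r ∘ +≤+))))

pulse-mass : ∀ n r R → suc r ≤ R →
             mass R (pulse n (+ r)) ≡ + (n ℕ.* twoSided (twoSided tri) (suc r))
pulse-mass n r R r<R = begin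
  mass R (pulse n (+ r))
    ≡⟨ mass-cong R (pulse-radial n r) ⟩
  mass R (λ f → + plateau n (suc r ℕ.∸ ‖ f ‖))
    ≡⟨ mass-radial plateau-runningSum (*-runningSum n tri-runningSum) R r<R ⟩
  + twoSided (twoSided (λ x → n ℕ.* tri x)) (suc r)
    ≡⟨ cong +_ (*-distribˡ-twoSided² n tri (suc r)) ⟨
  + (n ℕ.* twoSided (twoSided tri) (suc r)) ∎
  where
  open ≡-Reasoning
  plateau-runningSum : IsRunningSum (plateau n) (n ℕ.*_)
  plateau-runningSum = record { g-zero = refl ; G-zero = ℕ.*-zeroʳ n ; G-suc = ℕ.*-suc n }

⊖≤∸ : ∀ m n → m ℤ.⊖ n ≤ℤ + (m ℕ.∸ n)
⊖≤∸ m n with n ℕ.≤? m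
... | yes n≤m = ℤ.≤-reflexive (ℤ.⊖-≥ n≤m)
... | no  n≰m = subst (_≤ℤ + (m ℕ.∸ n)) (sym (ℤ.⊖-≰ n≰m)) ℤ.neg-≤-pos

aztec-≤-radial : ∀ n f → aztec n f ≤ℤ + (suc n ℕ.∸ ‖ f ‖)
aztec-≤-radial n f with f ≟F f₀
... | yes refl = +≤+ (ℕ.n≤1+n n)
... | no  _    =
  ℤ.⊔-lub (ℤ.≤-trans (ℤ.≤-reflexive (trans (shift (+ n) (+ ‖ f ‖))
                                            (ℤ.m-n≡m⊖n (suc n) ‖ f ‖)))
                     (⊖≤∸ (suc n) ‖ f ‖))
          (+≤+ z≤n)
  where
  shift : ∀ i j → i - j + + 1 ≡ + 1 + i - j
  shift = solve-∀

aztec-mass-≤ : ∀ n R → suc n ≤ R → mass R (aztec n) ≤ℤ + twoSided (twoSided tet) (suc n)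
aztec-mass-≤ n R n<R =
  ℤ.≤-trans (mass-mono-≤ R (aztec-≤-radial n))
            (ℤ.≤-reflexive (mass-radial tri-runningSum tet-runningSum R n<R))

BoundedBy : ℕ → Config → Set
BoundedBy n K = ∀ f → K f ≤ℤ + n

VanishesBeyond : ℕ → Config → Set
VanishesBeyond s K = ∀ f → s < ‖ f ‖ → K f ≡ + 0

pulse-bounded : ∀ n r → BoundedBy n (pulse n (+ r))
pulse-bounded n r f =
  subst (_≤ℤ + n) (sym (pulse-radial n r f)) (+≤+ (plateau≤ (suc r ℕ.∸ ‖ f ‖)))
  where
  plateau≤ : ∀ x → plateau n x ≤ n
  plateau≤ zero    = z≤n
  plateau≤ (suc _) = ℕ.≤-refl

pulse-vanishes : ∀ n r → VanishesBeyond r (pulse n (+ r))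
pulse-vanishes n r f r<‖f‖ =
  trans (pulse-radial n r f) (cong (+_ ∘ plateau n) (ℕ.m≤n⇒m∸n≡0 r<‖f‖))

nonzero⇒near : ∀ {s K f} → VanishesBeyond s K → K f ≢ + 0 → ‖ f ‖ ≤ s
nonzero⇒near {f = f} vanish Kf≢0 = ℕ.≮⇒≥ (λ s<‖f‖ → Kf≢0 (vanish f s<‖f‖))

far⇒≢ : ∀ {p h t} → ‖ p ‖ ≤ t → t < ‖ h ‖ → h ≢ p
far⇒≢ ‖p‖≤t t<‖h‖ refl = ℕ.<⇒≱ t<‖h‖ ‖p‖≤t

adjacent-sym : ∀ f g → Adjacent f g → Adjacent g f
adjacent-sym (a , b) (c , d) adj =
  trans (cong₂ ℕ._+_ (ℤ.∣i-j∣≡∣j-i∣ c a) (ℤ.∣i-j∣≡∣j-i∣ d b)) adj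

adjacent⇒‖g‖≤1+‖f‖ : ∀ f g → Adjacent f g → ‖ g ‖ ≤ suc ‖ f ‖
adjacent⇒‖g‖≤1+‖f‖ (a , b) (c , d) adj = begin
  ‖ (c , d) ‖
    ≡⟨ ‖a,b‖≡∣a∣+∣b∣ c d ⟩
  ∣ c ∣ ℕ.+ ∣ d ∣
    ≤⟨ ℕ.+-mono-≤ (∣j∣≤∣i∣+∣i-j∣ a c) (∣j∣≤∣i∣+∣i-j∣ b d) ⟩
  (∣ a ∣ ℕ.+ (∣ a - c ∣)) ℕ.+ (∣ b ∣ ℕ.+ (∣ b - d ∣))
    ≡⟨ ℕ+.interchange (∣ a ∣) _ (∣ b ∣) _ ⟩
  (∣ a ∣ ℕ.+ ∣ b ∣) ℕ.+ dist (a , b) (c , d)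
    ≡⟨ cong₂ ℕ._+_ (sym (‖a,b‖≡∣a∣+∣b∣ a b)) adj ⟩
  (‖ (a , b) ‖) ℕ.+ 1
    ≡⟨ ℕ.+-comm _ 1 ⟩
  suc (‖ (a , b) ‖) ∎
  where
  open ℕ.≤-Reasoning
  ∣j∣≤∣i∣+∣i-j∣ : ∀ i j → ∣ j ∣ ≤ ∣ i ∣ ℕ.+ ∣ i - j ∣
  ∣j∣≤∣i∣+∣i-j∣ i j =
    subst (λ k → ∣ k ∣ ≤ ∣ i ∣ ℕ.+ ∣ i - j ∣) (i-[i-j]≡j i j) (ℤ.∣i-j∣≤∣i∣+∣j∣ i (i - j))
    where
    i-[i-j]≡j : ∀ i j → i - (i - j) ≡ j
    i-[i-j]≡j = solve-∀

adjacent-f₀⇒near : ∀ {s} g → Adjacent f₀ g → ‖ g ‖ ≤ suc s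
adjacent-f₀⇒near {s} g adj = subst (_≤ suc s) (sym adj) (s≤s z≤n)

-- Faces of unequal weight cannot both lie where K vanishes.
fired-faces-near : ∀ {s K f g} → VanishesBeyond s K → Adjacent f g → K f ≢ K g →
                   ‖ f ‖ ≤ suc s × ‖ g ‖ ≤ suc s
fired-faces-near {K = K} {f} {g} vanish adj Kf≢Kg with K f ℤ.≟ + 0
... | no Kf≢0 = ℕ.m≤n⇒m≤1+n f-near , ℕ.≤-trans (adjacent⇒‖g‖≤1+‖f‖ f g adj) (s≤s f-near)
  where f-near = nonzero⇒near vanish Kf≢0
... | yes Kf≡0 =
  ℕ.≤-trans (adjacent⇒‖g‖≤1+‖f‖ g f (adjacent-sym f g adj)) (s≤s g-near) , ℕ.m≤n⇒m≤1+n g-near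
  where g-near = nonzero⇒near vanish (λ Kg≡0 → Kf≢Kg (trans Kf≡0 (sym Kg≡0)))

+2≤⇒+1≤ : ∀ {i} j → j + + 2 ≤ℤ i → j + + 1 ≤ℤ i
+2≤⇒+1≤ j j+2≤i = ℤ.≤-trans (ℤ.+-monoʳ-≤ j (+≤+ (s≤s z≤n))) j+2≤i

<⇒+1≤ : ∀ {i j} → j <ℤ i → j + + 1 ≤ℤ i
<⇒+1≤ {i} {j} j<i = subst (_≤ℤ i) (ℤ.+-comm (+ 1) j) (ℤ.i<j⇒suc[i]≤j j<i)

+1≤⇒< : ∀ {i j} → j + + 1 ≤ℤ i → j <ℤ i
+1≤⇒< {i} {j} j+1≤i = ℤ.suc[i]≤j⇒i<j (subst (_≤ℤ i) (ℤ.+-comm j (+ 1)) j+1≤i)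

+2≤⇒≢ : ∀ {i} j → j + + 2 ≤ℤ i → i ≢ j
+2≤⇒≢ j j+2≤i i≡j = ℤ.<⇒≢ (+1≤⇒< (+2≤⇒+1≤ j j+2≤i)) (sym i≡j)

transfer-pointwise : ∀ {K K' : Config} {f g} → f ≢ g → K' f ≡ K f - + 1 → K' g ≡ K g + + 1 →
                     (∀ h → h ≢ f → h ≢ g → K' h ≡ K h) →
                     ∀ h → K' h + δ f h ≡ K h + δ g h
transfer-pointwise {K} {K'} {f} {g} f≢g K'f K'g rest h = by-cases (h ≟F f) (h ≟F g)
  where
  -1+1 : ∀ i → i - + 1 + + 1 ≡ i + + 0
  -1+1 = solve-∀
  by-cases : Dec (h ≡ f) → Dec (h ≡ g) → K' h + δ f h ≡ K h + δ g h
  by-cases (yes refl) _ =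
    trans (cong₂ _+_ K'f (δ-same h))
          (trans (-1+1 (K h)) (cong (λ x → K h + x) (sym (δ-other f≢g))))
  by-cases (no h≢f) (yes refl) =
    trans (cong₂ _+_ K'g (δ-other h≢f))
          (trans (ℤ.+-identityʳ _) (cong (λ x → K h + x) (sym (δ-same h))))
  by-cases (no h≢f) (no h≢g) =
    cong₂ _+_ (rest h h≢f h≢g) (trans (δ-other h≢f) (sym (δ-other h≢g)))

inject-pointwise : ∀ {K K' : Config} {g} → K' g ≡ K g + + 1 → (∀ h → h ≢ g → K' h ≡ K h) →
                   ∀ h → K' h ≡ K h + δ g h
inject-pointwise {K} {K'} {g} K'g rest h = by-cases (h ≟F g)
  where
  by-cases : Dec (h ≡ g) → K' h ≡ K h + δ g h
  by-cases (yes refl) = trans K'g (cong (λ x → K h + x) (sym (δ-same h)))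
  by-cases (no h≢g)   =
    trans (rest h h≢g) (trans (sym (ℤ.+-identityʳ _)) (cong (λ x → K h + x) (sym (δ-other h≢g))))

mass-transfer : ∀ R {K K' : Config} f g → ‖ f ‖ < R → ‖ g ‖ < R →
                (∀ h → K' h + δ f h ≡ K h + δ g h) → mass R K' ≡ mass R K
mass-transfer R {K} {K'} f g f<R g<R pointwise = +-cancelʳ (+ 1) _ _ (begin
  mass R K' + + 1              ≡⟨ cong (λ x → mass R K' + x) (mass-δ R f f<R) ⟨
  mass R K' + mass R (δ f)     ≡⟨ mass-distrib-+ R K' (δ f) ⟨
  mass R (λ h → K' h + δ f h)  ≡⟨ mass-cong R pointwise ⟩
  mass R (λ h → K h + δ g h)   ≡⟨ mass-distrib-+ R K (δ g) ⟩
  mass R K + mass R (δ g)      ≡⟨ cong (λ x → mass R K + x) (mass-δ R g g<R) ⟩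
  mass R K + + 1               ∎)
  where open ≡-Reasoning

mass-inject : ∀ R {K K' : Config} g → ‖ g ‖ < R → (∀ h → K' h ≡ K h + δ g h) →
              mass R K' ≡ mass R K + + 1
mass-inject R {K} {K'} g g<R pointwise =
  trans (mass-cong R pointwise)
        (trans (mass-distrib-+ R K (δ g)) (cong (λ x → mass R K + x) (mass-δ R g g<R)))

fire-bounded : ∀ {n K K'} → BoundedBy n K → Fire n K K' → BoundedBy n K'
fire-bounded {n} {K} {K'} K≤n (fire-adj f g _ _ _ Kg+2≤Kf K'f K'g rest) h =
  by-cases (h ≟F f) (h ≟F g)
  where
  by-cases : Dec (h ≡ f) → Dec (h ≡ g) → K' h ≤ℤ + n
  by-cases (yes refl) _          = subst (_≤ℤ + n) (sym K'f) (ℤ.i≤j⇒i-k≤j (+ 1) (K≤n f))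
  by-cases (no _)     (yes refl) =
    subst (_≤ℤ + n) (sym K'g) (ℤ.≤-trans (+2≤⇒+1≤ (K g) Kg+2≤Kf) (K≤n f))
  by-cases (no h≢f)   (no h≢g)   = subst (_≤ℤ + n) (sym (rest h h≢f h≢g)) (K≤n h)
fire-bounded {n} {K} {K'} K≤n (fire-from-f₀ g _ Kg<n K'g rest) h = by-cases (h ≟F g)
  where
  by-cases : Dec (h ≡ g) → K' h ≤ℤ + n
  by-cases (yes refl) = subst (_≤ℤ + n) (sym K'g) (<⇒+1≤ Kg<n)
  by-cases (no h≢g)   = subst (_≤ℤ + n) (sym (rest h h≢g)) (K≤n h)
fire-bounded K≤n (fire-to-f₀ g _ n<Kg _ _) = ⊥-elim (ℤ.<⇒≱ n<Kg (K≤n g))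

fire-vanishes : ∀ {n s K K'} → VanishesBeyond s K → Fire n K K' → VanishesBeyond (suc s) K'
fire-vanishes {n} {s} {K} {K'} vanish fire h s<‖h‖ =
  trans (unchanged fire) (vanish h (ℕ.<-trans (ℕ.n<1+n s) s<‖h‖))
  where
  unchanged : Fire n K K' → K' h ≡ K h
  unchanged (fire-adj f g adj _ _ Kg+2≤Kf _ _ rest) =
    let (f-near , g-near) = fired-faces-near vanish adj (+2≤⇒≢ (K g) Kg+2≤Kf)
    in rest h (far⇒≢ f-near s<‖h‖) (far⇒≢ g-near s<‖h‖)
  unchanged (fire-from-f₀ g adj _ _ rest) = rest h (far⇒≢ (adjacent-f₀⇒near g adj) s<‖h‖)
  unchanged (fire-to-f₀ g adj _ _ rest)   = rest h (far⇒≢ (adjacent-f₀⇒near g adj) s<‖h‖)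

record _≼_ (K L : Config) : Set where
  constructor eventually
  field
    threshold : ℕ
    mass-≤    : ∀ R → threshold ≤ R → mass R K ≤ℤ mass R L

≼-trans : ∀ {K L M} → K ≼ L → L ≼ M → K ≼ M
≼-trans (eventually t₁ K≼L) (eventually t₂ L≼M) = eventually (t₁ ℕ.+ t₂) λ R t≤R →
  ℤ.≤-trans (K≼L R (ℕ.≤-trans (ℕ.m≤m+n t₁ t₂) t≤R))
            (L≼M R (ℕ.≤-trans (ℕ.m≤n+m t₂ t₁) t≤R))

fire-≼ : ∀ {n s K K'} → BoundedBy n K → VanishesBeyond s K → Fire n K K' → K ≼ K'
fire-≼ {s = s} {K} {K'} _ vanish (fire-adj f g adj _ _ Kg+2≤Kf K'f K'g rest) =
  eventually (suc (suc s)) λ R s+2≤R →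
    let (f-near , g-near) = fired-faces-near vanish adj Kf≢Kg
    in ℤ.≤-reflexive (sym (mass-transfer R {K} {K'} f g
         (ℕ.<-≤-trans (s≤s f-near) s+2≤R) (ℕ.<-≤-trans (s≤s g-near) s+2≤R)
         (transfer-pointwise (Kf≢Kg ∘ cong K) K'f K'g rest)))
  where
  Kf≢Kg = +2≤⇒≢ (K g) Kg+2≤Kf
fire-≼ {s = s} {K} {K'} _ _ (fire-from-f₀ g adj _ K'g rest) =
  eventually (suc (suc s)) λ R s+2≤R →
    subst (mass R K ≤ℤ_)
          (sym (mass-inject R {K} {K'} g (ℕ.<-≤-trans (s≤s (adjacent-f₀⇒near g adj)) s+2≤R)
                                         (inject-pointwise K'g rest)))
          (ℤ.i≤i+j (mass R K) (+ 1))
fire-≼ K≤n _ (fire-to-f₀ g _ n<Kg _ _) = ⊥-elim (ℤ.<⇒≱ n<Kg (K≤n g))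

reaches-≼ : ∀ {n s K L} → BoundedBy n K → VanishesBeyond s K → Reaches n K L → K ≼ L
reaches-≼ _ _ ε = eventually 0 λ _ _ → ℤ.≤-refl
reaches-≼ K≤n vanish (fire ◅ fires) =
  ≼-trans (fire-≼ K≤n vanish fire)
          (reaches-≼ (fire-bounded K≤n fire) (fire-vanishes vanish fire) fires)

theorem6p3 : (n : ℕ) → 1 ≤ n → (r : ℤ) → (c : ℕ) → IsCeilDivSqrt3 n c →
    + suc c ≤ℤ r →
    ¬ (∃ λ K → Reaches n (pulse n r) K × (K ≗c aztec n))
theorem6p3 (suc m) _ (+ suc q) c (n²≤3c² , _) (+≤+ (s≤s c≤q)) (K , pulse↝K , K≗Az) =
  let eventually t pulse≼K = reaches-≼ (pulse-bounded n r) (pulse-vanishes n r) pulse↝K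
      R = t ℕ.+ (suc r ℕ.+ suc n)
      r<R = ℕ.≤-trans (ℕ.m≤m+n (suc r) (suc n)) (ℕ.m≤n+m _ t)
      n<R = ℕ.≤-trans (ℕ.m≤n+m (suc n) (suc r)) (ℕ.m≤n+m _ t)
  in ℕ.<⇒≱ (twoSided²-tet<twoSided²-tri m q n²≤3q²) (ℤ.drop‿+≤+ (begin
       + (n ℕ.* twoSided (twoSided tri) (suc r))  ≡⟨ pulse-mass n r R r<R ⟨
       mass R (pulse n (+ r))                      ≤⟨ pulse≼K R (ℕ.m≤m+n t _) ⟩
       mass R K                                    ≡⟨ mass-cong R K≗Az ⟩
       mass R (aztec n)                            ≤⟨ aztec-mass-≤ n R n<R ⟩
       + twoSided (twoSided tet) (suc n)           ∎))
  where
  open ℤ.≤-Reasoning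
  n = suc m
  r = suc q
  n²≤3q² : n ℕ.* n ≤ 3 ℕ.* (q ℕ.* q)
  n²≤3q² = ℕ.≤-trans n²≤3c² (ℕ.*-monoʳ-≤ 3 (ℕ.*-mono-≤ c≤q c≤q))
theorem6p3 zero () _ _ _ _ _
theorem6p3 (suc _) _ -[1+ _ ] _ _ () _
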